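{- Let $C$ be a latin $n$-cube or a layer-latin $n$-cube of order $q$, let $1\le k\le n-1$, and let $y^1,\dots,y^q\in Q_q^k$ be such that for each $j=1,\dots,k$ the values $y^1_j,\dots,y^q_j$ are pairwise distinct. For $i=1,\dots,q$ let $C_i$ be the retract $z\mapsto C(y^i,z)$, $z\in Q_q^{n-k}$, and let $D$ be the layer-latin $(n-k+1)$-cube of order $q$ with layers $C_1,\dots,C_q$, i.e. $D(i,z)=C(y^i,z)$. If $\{(i_1,z^1),\dots,(i_q,z^q)\}$ is a transversal of $D$, then $\{(y^{i_1},z^1),\dots,(y^{i_q},z^q)\}$ is a transversal of $C$.
   Context: $Q_q=\{0,\dots,q-1\}$ (layers of $D$ are indexed by $1,\dots,q$). A latin $m$-cube of order $q$ is a map $Q_q^m\to Q_q$ such that every line (cells obtained by fixing all coordinates but one) contains all $q$ symbols. A layer-latin $m$-cube of order $q$ is an array $Q_q^m\to Q_q$ (first coordinate possibly indexed by any $q$-element set) each of whose layers (first coordinate fixed) is a latin $(m-1)$-cube. A retract is obtained by fixing some of the coordinates. A hyperplane of an $m$-dimensional array is the set of cells obtained by fixing one coordinate at one value; a transversal of a latin or layer-latin $m$-cube of order $q$ is a set of $q$ cells with at most one cell in each hyperplane and pairwise distinct symbols. -}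

module Defs where

open import Data.Nat using (ℕ; zero; suc)
open import Data.Fin using (Fin)
open import Data.Unit using (⊤)
open import Data.Product using (∃; _×_)
open import Data.Vec.Functional using (Vector; updateAt; _∷_)
open import Function using (const)
open import Relation.Binary.PropositionalEquality using (_≡_)

-- Q_q = Fin q ; a cell of an m-dimensional array of order q is a vector Fin m → Fin q
Cell : ℕ → ℕ → Set
Cell m q = Vector (Fin q) m

Cube : ℕ → ℕ → Set
Cube m q = Cell m q → Fin q

IsLatin : ∀ {m q} → Cube m q → Set
IsLatin {m} {q} C = ∀ (x : Cell m q) (j : Fin m) (s : Fin q) →
  ∃ λ (a : Fin q) → C (updateAt x j (const a)) ≡ s

-- each layer (first coordinate fixed) is a latin (m-1)-cube
-- (a 0-dimensional array has no layers; this case is irrelevant below)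
IsLayerLatin : ∀ {m q} → Cube m q → Set
IsLayerLatin {zero}  C = ⊤
IsLayerLatin {suc m} {q} C = ∀ (i : Fin q) → IsLatin (λ z → C (i ∷ z))

-- a transversal given as a list T_1..T_q of q cells: at most one cell in each
-- hyperplane (coordinate j fixed) and pairwise distinct symbols
IsTransversal : ∀ {m q} → Cube m q → (Fin q → Cell m q) → Set
IsTransversal {m} {q} C T =
  (∀ (t t' : Fin q) (j : Fin m) → T t j ≡ T t' j → t ≡ t') ×
  (∀ (t t' : Fin q) → C (T t) ≡ C (T t') → t ≡ t')

module Submission where

open import Defs
open import Data.Nat using (ℕ; suc; _+_; _≤_)
open import Data.Fin using (Fin; splitAt; zero; suc)
open import Data.Sum using (_⊎_; inj₁; inj₂)
open import Data.Product using (∃; _,_)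
open import Data.Vec.Functional using (_++_; head; tail)
open import Function using (_∘_)
open import Relation.Binary.PropositionalEquality using (_≡_)

ReflectsHyperplanes : ∀ {n m q} → (Cell n q → Cell m q) → Set
ReflectsHyperplanes {n} {m} {q} φ =
  ∀ (j : Fin m) → ∃ λ (j' : Fin n) → ∀ (x x' : Cell n q) → φ x j ≡ φ x' j → x j' ≡ x' j'

transversal-image : ∀ {n m q} (C : Cube m q) (φ : Cell n q → Cell m q) →
  ReflectsHyperplanes φ → (T : Fin q → Cell n q) →
  IsTransversal (C ∘ φ) T → IsTransversal C (φ ∘ T)
transversal-image C φ reflects T (hyperplanes , symbols) = hyperplanes′ , symbols
  where
  hyperplanes′ : ∀ t t' j → φ (T t) j ≡ φ (T t') j → t ≡ t'
  hyperplanes′ t t' j e with reflects j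
  ... | j' , reflect = hyperplanes t t' j' (reflect (T t) (T t') e)

substitute-reflectsHyperplanes : ∀ {k m q} (y : Fin q → Cell k q) →
  (∀ (j : Fin k) (i i' : Fin q) → y i j ≡ y i' j → i ≡ i') →
  ReflectsHyperplanes {suc m} {k + m} (λ x → y (head x) ++ tail x)
substitute-reflectsHyperplanes {k} y y-injective j with splitAt k j
... | inj₁ j' = zero , λ x x' → y-injective j' (head x) (head x')
... | inj₂ j' = suc j' , λ _ _ e → e

proposition4 : (q k m : ℕ) → 1 ≤ k → 1 ≤ m →
    (C : Cube (k + m) q) → IsLatin C ⊎ IsLayerLatin C →
    (y : Fin q → Cell k q) →
    (∀ (j : Fin k) (i i' : Fin q) → y i j ≡ y i' j → i ≡ i') →
    (T : Fin q → Cell (suc m) q) →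
    IsTransversal {suc m} {q} (λ x → C (y (head x) ++ tail x)) T →
    IsTransversal C (λ t → y (head (T t)) ++ tail (T t))
proposition4 q k m _ _ C _ y y-injective =
  transversal-image C (λ x → y (head x) ++ tail x)
    (substitute-reflectsHyperplanes y y-injective)
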